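{- Let $k\ge2$ be an integer and let $H_1,\dots,H_k$ be graphs such that $H_j$ is $a_j$-regular, where $a_1<a_2<\cdots<a_k$ are positive integers. Suppose that for every $1\le i<k$, $$\max_{u\in V(H_{i+1})} e[u] < \min_{v\in V(H_i)} e[v].$$ Then $G=H_1\,\square\,H_2\,\square\cdots\square\,H_k$ is an $(a_1,\dots,a_k)$-flip graph.
   Context: All graphs are finite and simple. For a vertex $u$ of an (uncoloured) graph, $e[u]$ is the number of edges of the subgraph induced by the closed neighbourhood $N[u]=N(u)\cup\{u\}$. The Cartesian product $G\,\square\,H$ has vertex set $V(G)\times V(H)$, with $(u,v)\sim(u',v')$ iff either $u=u'$ and $vv'\in E(H)$, or $v=v'$ and $uu'\in E(G)$; it is associative. Given an edge-colouring $f:E(G)\to\{1,\dots,k\}$, let $E(j)$ be the edges of colour $j$, $\deg_j(v)$ the number of colour-$j$ edges at $v$, and $e_j[v]$ the number of colour-$j$ edges with both endpoints in $N[v]$. For a strictly increasing sequence of positive integers $(a_1,\dots,a_k)$, a graph $G$ is an $(a_1,\dots,a_k)$-flip graph if there is a colouring $f:E(G)\to\{1,\dots,k\}$ with $\deg_j(v)=a_j$ for all $j$ and all vertices $v$, and $e_k[v]<e_{k-1}[v]<\cdots<e_1[v]$ for every vertex $v$. -}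

module Defs where

open import Data.Nat using (ℕ; zero; suc; _+_; _*_; _<_; _≤_)
open import Data.Bool using (Bool; true; false; _∧_; _∨_; if_then_else_)
open import Data.Fin using (Fin; toℕ; remQuot; _≟_)
import Data.Fin as F
open import Data.Product using (Σ; _×_; _,_; proj₁; proj₂; ∃)
open import Relation.Nullary.Decidable using (⌊_⌋)
open import Relation.Binary.PropositionalEquality using (_≡_)
import Data.Nat as N

record Graph : Set where
  constructor mkGraph
  field
    n   : ℕ
    adj : Fin n → Fin n → Bool
open Graph public

IsSimple : Graph → Set
IsSimple G = (∀ x y → adj G x y ≡ adj G y x) × (∀ x → adj G x x ≡ false)

count : ∀ {n} → (Fin n → Bool) → ℕ
count {zero}  p = 0
count {suc n} p = (if p F.zero then 1 else 0) + count (λ x → p (F.suc x))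

sumF : ∀ {n} → (Fin n → ℕ) → ℕ
sumF {zero}  f = 0
sumF {suc n} f = f F.zero + sumF (λ x → f (F.suc x))

_==_ : ∀ {n} → Fin n → Fin n → Bool
x == y = ⌊ x ≟ y ⌋

_<ᵇ_ : ∀ {n} → Fin n → Fin n → Bool
x <ᵇ y = ⌊ toℕ x N.<? toℕ y ⌋

deg : (G : Graph) → Fin (n G) → ℕ
deg G v = count (λ w → adj G v w)

inN : (G : Graph) → Fin (n G) → Fin (n G) → Bool
inN G u w = (w == u) ∨ adj G u w

countEdges : (G : Graph) → (Fin (n G) → Fin (n G) → Bool) → ℕ
countEdges G q = sumF (λ x → count (λ y → (x <ᵇ y) ∧ adj G x y ∧ q x y))

e : (G : Graph) → Fin (n G) → ℕ
e G u = countEdges G (λ x y → inN G u x ∧ inN G u y)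

Regular : ℕ → Graph → Set
Regular a G = ∀ v → deg G v ≡ a

-- Cartesian product; vertex (i , j) is encoded as combine i j : Fin (n G * n H)
_□_ : Graph → Graph → Graph
G □ H = mkGraph (n G * n H) λ p q →
  let (i , j) = remQuot (n H) p ; (i' , j') = remQuot (n H) q
  in ((i == i') ∧ adj H j j') ∨ ((j == j') ∧ adj G i i')

prodAll : (m : ℕ) → (Fin (suc m) → Graph) → Graph
prodAll zero    H = H F.zero
prodAll (suc m) H = H F.zero □ prodAll m (λ i → H (F.suc i))

-- Edge colourings with colours Fin k (colour j ↔ colour j+1 of the paper),
-- as symmetric functions on pairs; only values on edges are relevant.
IsColouring : (G : Graph) (k : ℕ) → (Fin (n G) → Fin (n G) → Fin k) → Set
IsColouring G k c = ∀ x y → adj G x y ≡ true → c x y ≡ c y x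

degC : (G : Graph) {k : ℕ} → (Fin (n G) → Fin (n G) → Fin k) → Fin k → Fin (n G) → ℕ
degC G c j v = count (λ w → adj G v w ∧ (c v w == j))

eC : (G : Graph) {k : ℕ} → (Fin (n G) → Fin (n G) → Fin k) → Fin k → Fin (n G) → ℕ
eC G c j v = countEdges G (λ x y → inN G v x ∧ inN G v y ∧ (c x y == j))

StrictlyIncPos : (k : ℕ) → (Fin k → ℕ) → Set
StrictlyIncPos k a = (∀ i → 1 ≤ a i) × (∀ i j → toℕ j ≡ suc (toℕ i) → a i < a j)

IsFlipGraph : (G : Graph) (k : ℕ) (a : Fin k → ℕ) → Set
IsFlipGraph G k a =
  StrictlyIncPos k a ×
  Σ (Fin (n G) → Fin (n G) → Fin k) λ c →
    IsColouring G k c ×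
    (∀ j v → degC G c j v ≡ a j) ×
    (∀ i j v → toℕ j ≡ suc (toℕ i) → eC G c j v < eC G c i v)

-- Colour every edge of H₁ □ ⋯ □ Hₖ by the coordinate in which its two ends differ. The colour-j
-- edges at v are the Hⱼ-edges at vⱼ, so deg_j(v) = aⱼ. A colour-j edge inside N[v] stays in the
-- copy of Hⱼ through v: were one end to differ from v in a coordinate i ≠ j, the other end would
-- differ from v in both i and j and so lie outside N[v]. Hence e_j[v] is e[vⱼ] computed in Hⱼ,
-- and the hypothesis on the factors becomes the required chain of inequalities.
module Submission where

open import Defs
open import Data.Nat using (ℕ; zero; suc; _+_; _*_; _<_)
import Data.Nat.Properties as ℕ
open import Data.Bool using (Bool; true; false; T; _∧_; _∨_; if_then_else_)
open import Data.Bool.Properties using (T-∧; T-∨; ∧-identityʳ; ∧-zeroʳ; ∨-identityʳ)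
open import Data.Fin using (Fin; zero; suc; toℕ; remQuot; quotRem; combine; _≟_; _↑ˡ_; _↑ʳ_)
open import Data.Fin.Properties
  using (suc-injective; remQuot-combine; combine-remQuot; combine-injective; combine-injectiveˡ;
         combine-injectiveʳ; combine-monoˡ-<; toℕ-combine)
open import Data.Product using (_×_; _,_; proj₁; proj₂; uncurry; swap)
open import Data.Sum using (_⊎_; inj₁; inj₂)
open import Data.Empty using (⊥-elim)
open import Function using (_∘_; _⇔_; mk⇔; Equivalence)
open import Relation.Nullary using (¬_; yes; no)
open import Relation.Nullary.Decidable using (does; isYes; isYes≗does; does-⇔; toWitness; fromWitness)
open import Relation.Binary.PropositionalEquality

open Equivalence using (to; from)

indicator : Bool → ℕ
indicator b = if b then 1 else 0

indicator-¬T : ∀ {b} → ¬ T b → indicator b ≡ 0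
indicator-¬T {false} _  = refl
indicator-¬T {true}  ¬t = ⊥-elim (¬t _)

sumF-cong : ∀ {m} {f g : Fin m → ℕ} → (∀ x → f x ≡ g x) → sumF f ≡ sumF g
sumF-cong {zero}  _ = refl
sumF-cong {suc m} h = cong₂ _+_ (h zero) (sumF-cong (h ∘ suc))

sumF-zero : ∀ {m} {f : Fin m → ℕ} → (∀ x → f x ≡ 0) → sumF f ≡ 0
sumF-zero {zero}  _ = refl
sumF-zero {suc m} h = cong₂ _+_ (h zero) (sumF-zero (h ∘ suc))

sumF-point : ∀ {m} {f : Fin m → ℕ} (x : Fin m) → (∀ y → y ≢ x → f y ≡ 0) → sumF f ≡ f x
sumF-point {suc m} {f} zero h =
  trans (cong (f zero +_) (sumF-zero (λ y → h (suc y) λ ()))) (ℕ.+-identityʳ _)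
sumF-point {suc m} {f} (suc x) h =
  cong₂ _+_ (h zero λ ()) (sumF-point x (λ y y≢x → h (suc y) (y≢x ∘ suc-injective)))

sumF-↑ : ∀ a {b} (f : Fin (a + b) → ℕ) →
         sumF f ≡ sumF (λ i → f (i ↑ˡ b)) + sumF (λ j → f (a ↑ʳ j))
sumF-↑ zero    f = refl
sumF-↑ (suc a) f = trans (cong (f zero +_) (sumF-↑ a (f ∘ suc))) (sym (ℕ.+-assoc (f zero) _ _))

sumF-combine : ∀ a {b} (f : Fin (a * b) → ℕ) →
               sumF f ≡ sumF (λ i → sumF (λ j → f (combine {a} {b} i j)))
sumF-combine zero        f = refl
sumF-combine (suc a) {b} f =
  trans (sumF-↑ b f) (cong (sumF (λ j → f (j ↑ˡ (a * b))) +_) (sumF-combine a (λ x → f (b ↑ʳ x))))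

count-sumF : ∀ {m} (p : Fin m → Bool) → count p ≡ sumF (indicator ∘ p)
count-sumF {zero}  p = refl
count-sumF {suc m} p = cong (indicator (p zero) +_) (count-sumF (p ∘ suc))

count-cong : ∀ {m} {p q : Fin m → Bool} → (∀ x → p x ≡ q x) → count p ≡ count q
count-cong {zero}  _ = refl
count-cong {suc m} h = cong₂ _+_ (cong indicator (h zero)) (count-cong (h ∘ suc))

count-none : ∀ {m} {p : Fin m → Bool} → (∀ x → ¬ T (p x)) → count p ≡ 0
count-none {p = p} h = trans (count-sumF p) (sumF-zero (indicator-¬T ∘ h))

countEdges-cong : ∀ G {q r : Fin (n G) → Fin (n G) → Bool} → (∀ x y → q x y ≡ r x y) →
                  countEdges G q ≡ countEdges G r
countEdges-cong G h =
  sumF-cong λ x → count-cong λ y → cong (λ b → (x <ᵇ y) ∧ adj G x y ∧ b) (h x y)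

module _ {a b : ℕ} where

  ∀-combine : {P : Fin (a * b) → Set} → (∀ x y → P (combine x y)) → ∀ v → P v
  ∀-combine {P} h v = subst P (combine-remQuot {a} b v) (uncurry h (remQuot {a} b v))

  at-remQuot : {f : Fin (a * b) → ℕ} {g : Fin a → Fin b → ℕ} → (∀ x y → f (combine x y) ≡ g x y) →
               ∀ v → f v ≡ uncurry g (remQuot b v)
  at-remQuot {f} {g} h v =
    subst (λ w → f w ≡ uncurry g (remQuot b v)) (combine-remQuot {a} b v) (uncurry h (remQuot {a} b v))

  sumF-sliceʳ : (j : Fin b) (f : Fin (a * b) → ℕ) →
                (∀ (x : Fin a) y → y ≢ j → f (combine x y) ≡ 0) →
                sumF f ≡ sumF {a} (λ x → f (combine x j))
  sumF-sliceʳ j f h = trans (sumF-combine a {b} f) (sumF-cong λ x → sumF-point j (h x))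

  sumF-sliceˡ : (i : Fin a) (f : Fin (a * b) → ℕ) →
                (∀ x (y : Fin b) → x ≢ i → f (combine x y) ≡ 0) →
                sumF f ≡ sumF (λ y → f (combine i y))
  sumF-sliceˡ i f h =
    trans (sumF-combine a {b} f) (sumF-point i λ x x≢i → sumF-zero λ y → h x y x≢i)

  count-sliceʳ : (j : Fin b) (p : Fin (a * b) → Bool) →
                 (∀ (x : Fin a) y → T (p (combine x y)) → y ≡ j) →
                 count p ≡ count {a} (λ x → p (combine x j))
  count-sliceʳ j p h = begin
    count p                                         ≡⟨ count-sumF p ⟩
    sumF (indicator ∘ p)
      ≡⟨ sumF-sliceʳ j _ (λ x y y≢j → indicator-¬T (y≢j ∘ h x y)) ⟩
    sumF {a} (λ x → indicator (p (combine x j)))    ≡⟨ count-sumF {a} (λ x → p (combine x j)) ⟨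
    count {a} (λ x → p (combine x j))               ∎
    where open ≡-Reasoning

  count-sliceˡ : (i : Fin a) (p : Fin (a * b) → Bool) →
                 (∀ x (y : Fin b) → T (p (combine x y)) → x ≡ i) →
                 count p ≡ count (λ y → p (combine i y))
  count-sliceˡ i p h = begin
    count p                                         ≡⟨ count-sumF p ⟩
    sumF (indicator ∘ p)
      ≡⟨ sumF-sliceˡ i _ (λ x y x≢i → indicator-¬T (x≢i ∘ h x y)) ⟩
    sumF (λ y → indicator (p (combine i y)))        ≡⟨ count-sumF (λ y → p (combine i y)) ⟨
    count (λ y → p (combine i y))                   ∎
    where open ≡-Reasoning

  pairs-sliceʳ : (j : Fin b) (R : Fin (a * b) → Fin (a * b) → Bool) →
                 (∀ (x x' : Fin a) y y' → T (R (combine x y) (combine x' y')) → y ≡ j × y' ≡ j) →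
                 sumF (λ p → count (R p)) ≡
                 sumF {a} (λ x → count {a} (λ x' → R (combine x j) (combine x' j)))
  pairs-sliceʳ j R h = trans
    (sumF-sliceʳ j (λ p → count (R p)) λ x y y≢j →
      count-none (∀-combine λ (x' : Fin a) y' → y≢j ∘ proj₁ ∘ h x x' y y'))
    (sumF-cong λ x → count-sliceʳ j (R (combine x j)) λ x' y' → proj₂ ∘ h x x' j y')

  pairs-sliceˡ : (i : Fin a) (R : Fin (a * b) → Fin (a * b) → Bool) →
                 (∀ x x' (y y' : Fin b) → T (R (combine x y) (combine x' y')) → x ≡ i × x' ≡ i) →
                 sumF (λ p → count (R p)) ≡
                 sumF (λ y → count (λ y' → R (combine i y) (combine i y')))
  pairs-sliceˡ i R h = trans
    (sumF-sliceˡ i (λ p → count (R p)) λ x y x≢i →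
      count-none (∀-combine λ (x' : Fin a) y' → x≢i ∘ proj₁ ∘ h x x' y y'))
    (sumF-cong λ y → count-sliceˡ i (R (combine i y)) λ x' y' → proj₂ ∘ h i x' y y')

==-refl : ∀ {m} (x : Fin m) → x == x ≡ true
==-refl x = cong isYes (≡-≟-identity _≟_ refl)

==-≢ : ∀ {m} {x y : Fin m} → x ≢ y → x == y ≡ false
==-≢ x≢y = cong isYes (≢-≟-identity _≟_ x≢y)

==-sym : ∀ {m} (x y : Fin m) → x == y ≡ y == x
==-sym x y with x ≟ y | y ≟ x
... | yes _   | yes _   = refl
... | no  _   | no  _   = refl
... | yes x≡y | no  y≢x = ⊥-elim (y≢x (sym x≡y))
... | no  x≢y | yes y≡x = ⊥-elim (x≢y (sym y≡x))

suc-== : ∀ {m} (x y : Fin m) → suc x == suc y ≡ x == y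
suc-== x y with x ≟ y
... | yes _ = refl
... | no  _ = refl

combine-== : ∀ {a b} (x x' : Fin a) (y y' : Fin b) →
             combine x y == combine x' y' ≡ (x == x') ∧ (y == y')
combine-== x x' y y' with x ≟ x' | y ≟ y'
... | yes refl | yes refl = ==-refl (combine x y)
... | yes refl | no  y≢y' = ==-≢ (y≢y' ∘ combine-injectiveʳ x y x y')
... | no  x≢x' | _        = ==-≢ (x≢x' ∘ combine-injectiveˡ x y x' y')

<ᵇ-⇔ : ∀ {m m'} {x y : Fin m} {x' y' : Fin m'} →
       toℕ x < toℕ y ⇔ toℕ x' < toℕ y' → x <ᵇ y ≡ x' <ᵇ y'
<ᵇ-⇔ {x = x} {y} {x'} {y'} iff = begin
  isYes (toℕ x ℕ.<? toℕ y)    ≡⟨ isYes≗does (toℕ x ℕ.<? toℕ y) ⟩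
  does (toℕ x ℕ.<? toℕ y)     ≡⟨ does-⇔ iff (toℕ x ℕ.<? toℕ y) (toℕ x' ℕ.<? toℕ y') ⟩
  does (toℕ x' ℕ.<? toℕ y')   ≡⟨ isYes≗does (toℕ x' ℕ.<? toℕ y') ⟨
  isYes (toℕ x' ℕ.<? toℕ y')  ∎
  where open ≡-Reasoning

module _ {a b : ℕ} where

  combine-<ᵇˡ : (i : Fin a) (y y' : Fin b) → combine i y <ᵇ combine i y' ≡ y <ᵇ y'
  combine-<ᵇˡ i y y' = <ᵇ-⇔ (mk⇔ cancel mono)
    where
    cancel : toℕ (combine i y) < toℕ (combine i y') → toℕ y < toℕ y'
    cancel lt = ℕ.+-cancelˡ-< (b * toℕ i) _ _ (subst₂ _<_ (toℕ-combine i y) (toℕ-combine i y') lt)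
    mono : toℕ y < toℕ y' → toℕ (combine i y) < toℕ (combine i y')
    mono lt =
      subst₂ _<_ (sym (toℕ-combine i y)) (sym (toℕ-combine i y')) (ℕ.+-monoʳ-< (b * toℕ i) lt)

  combine-<ᵇʳ : (x x' : Fin a) (j : Fin b) → combine x j <ᵇ combine x' j ≡ x <ᵇ x'
  combine-<ᵇʳ x x' j = <ᵇ-⇔ (mk⇔ cancel (combine-monoˡ-< j j))
    where
    cancel : toℕ (combine x j) < toℕ (combine x' j) → toℕ x < toℕ x'
    cancel lt = ℕ.*-cancelˡ-< b _ _
      (ℕ.+-cancelʳ-< (toℕ j) _ _ (subst₂ _<_ (toℕ-combine x j) (toℕ-combine x' j) lt))

Colouring : Graph → ℕ → Set
Colouring G k = Fin (n G) → Fin (n G) → Fin k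

adj-irrefl : ∀ {G} → IsSimple G → ∀ x → ¬ T (adj G x x)
adj-irrefl (_ , loopless) x = subst T (loopless x)

inN-refl : ∀ G u → T (inN G u u)
inN-refl G u = from (T-∨ {u == u}) (inj₁ (fromWitness refl))

colourNeighbour : (G : Graph) {k : ℕ} → Colouring G k → Fin k → Fin (n G) → Fin (n G) → Bool
colourNeighbour G c j v w = adj G v w ∧ (c v w == j)

colourEdgeIn : (G : Graph) {k : ℕ} → Colouring G k → Fin k → Fin (n G) → Fin (n G) → Fin (n G) → Bool
colourEdgeIn G c j v x y = (x <ᵇ y) ∧ adj G x y ∧ inN G v x ∧ inN G v y ∧ (c x y == j)

colourEdgeIn⁻ : ∀ G {k} (c : Colouring G k) j v x y → T (colourEdgeIn G c j v x y) →
                T (adj G x y) × T (inN G v x) × T (inN G v y) × T (c x y == j)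
colourEdgeIn⁻ G c j v x y t =
  let (_  , t₁) = to (T-∧ {x <ᵇ y}) t
      (xy , t₂) = to (T-∧ {adj G x y}) t₁
      (vx , t₃) = to (T-∧ {inN G v x}) t₂
      (vy , cj) = to (T-∧ {inN G v y}) t₃
  in xy , vx , vy , cj

edgeIn : (G : Graph) → Fin (n G) → Fin (n G) → Fin (n G) → Bool
edgeIn G u x y = (x <ᵇ y) ∧ adj G x y ∧ inN G u x ∧ inN G u y

module Product {G K : Graph} where

  -- remQuot unfolds to swap ∘ quotRem, so goals about G □ K mention quotRem, and rewriting needs this form.
  quotRem-combine : ∀ (x : Fin (n G)) (y : Fin (n K)) → quotRem (n K) (combine x y) ≡ (y , x)
  quotRem-combine x y = cong swap (remQuot-combine x y)

  adj-□ : ∀ (x x' : Fin (n G)) (y y' : Fin (n K)) →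
          adj (G □ K) (combine x y) (combine x' y') ≡ ((x == x') ∧ adj K y y') ∨ ((y == y') ∧ adj G x x')
  adj-□ x x' y y' rewrite quotRem-combine x y | quotRem-combine x' y' = refl

  adj-□⁻ : ∀ {x x' y y'} → T (adj (G □ K) (combine x y) (combine x' y')) →
           (x ≡ x' × T (adj K y y')) ⊎ (y ≡ y' × T (adj G x x'))
  adj-□⁻ {x} {x'} {y} {y'} t with to (T-∨ {(x == x') ∧ adj K y y'}) (subst T (adj-□ x x' y y') t)
  ... | inj₁ t' = let (x≡x' , a) = to (T-∧ {x == x'}) t' in inj₁ (toWitness x≡x' , a)
  ... | inj₂ t' = let (y≡y' , a) = to (T-∧ {y == y'}) t' in inj₂ (toWitness y≡y' , a)

  inN-□⁻ : ∀ {i j x y} → T (inN (G □ K) (combine i j) (combine x y)) →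
           (x ≡ i × T (inN K j y)) ⊎ (y ≡ j × T (inN G i x))
  inN-□⁻ {i} {j} {x} {y} t with to (T-∨ {combine x y == combine i j}) t
  ... | inj₁ v≡w with combine-injective x y i j (toWitness v≡w)
  ...   | refl , refl = inj₁ (refl , inN-refl K j)
  inN-□⁻ {i} {j} {x} {y} t | inj₂ a with adj-□⁻ a
  ...   | inj₁ (refl , a') = inj₁ (refl , from (T-∨ {y == j}) (inj₂ a'))
  ...   | inj₂ (refl , a') = inj₂ (refl , from (T-∨ {x == i}) (inj₂ a'))

  □-simple : IsSimple G → IsSimple K → IsSimple (G □ K)
  □-simple (G-sym , G-loopless) (K-sym , K-loopless) =
    (λ p q → ∀-combine (λ x y → ∀-combine (λ x' y' → symmetric x x' y y') q) p) ,
    ∀-combine loopless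
    where
    symmetric : ∀ (x x' : Fin (n G)) (y y' : Fin (n K)) →
                adj (G □ K) (combine x y) (combine x' y') ≡ adj (G □ K) (combine x' y') (combine x y)
    symmetric x x' y y' rewrite adj-□ x x' y y' | adj-□ x' x y' y
                              | ==-sym x x' | ==-sym y y' | K-sym y y' | G-sym x x' = refl
    loopless : ∀ (x : Fin (n G)) (y : Fin (n K)) → adj (G □ K) (combine x y) (combine x y) ≡ false
    loopless x y rewrite adj-□ x x y y | ==-refl x | ==-refl y | K-loopless y | G-loopless x = refl

  module Slices (G-simple : IsSimple G) (K-simple : IsSimple K) where

    adj-□-sliceʳ : ∀ x x' (j : Fin (n K)) → adj (G □ K) (combine x j) (combine x' j) ≡ adj G x x'
    adj-□-sliceʳ x x' j
      rewrite adj-□ x x' j j | ==-refl j | proj₂ K-simple j | ∧-zeroʳ (x == x') = refl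

    adj-□-sliceˡ : ∀ (i : Fin (n G)) y y' → adj (G □ K) (combine i y) (combine i y') ≡ adj K y y'
    adj-□-sliceˡ i y y'
      rewrite adj-□ i i y y' | ==-refl i | proj₂ G-simple i
            | ∧-zeroʳ (y == y') | ∨-identityʳ (adj K y y') = refl

    inN-□-sliceʳ : ∀ i (j : Fin (n K)) x → inN (G □ K) (combine i j) (combine x j) ≡ inN G i x
    inN-□-sliceʳ i j x
      rewrite combine-== x i j j | ==-refl j | ∧-identityʳ (x == i) | adj-□-sliceʳ i x j = refl

    inN-□-sliceˡ : ∀ (i : Fin (n G)) j y → inN (G □ K) (combine i j) (combine i y) ≡ inN K j y
    inN-□-sliceˡ i j y rewrite combine-== i i y j | ==-refl i | adj-□-sliceˡ i j y = refl

productColouring : ∀ G K {k} → Colouring K k → Colouring (G □ K) (suc k)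
productColouring G K c p q =
  let (x , y) = remQuot {n G} (n K) p ; (x' , y') = remQuot {n G} (n K) q
  in if x == x' then suc (c y y') else zero

module ProductColouring {G K : Graph} {k : ℕ} (c : Colouring K k) where

  open Product {G} {K}

  colour : Colouring (G □ K) (suc k)
  colour = productColouring G K c

  colour-combine : ∀ x x' y y' →
                   colour (combine x y) (combine x' y') ≡ (if x == x' then suc (c y y') else zero)
  colour-combine x x' y y' rewrite quotRem-combine x y | quotRem-combine x' y' = refl

  colour-same : ∀ x y y' → colour (combine x y) (combine x y') ≡ suc (c y y')
  colour-same x y y' rewrite colour-combine x x y y' | ==-refl x = refl

  colour-distinct : ∀ {x x'} y y' → x ≢ x' → colour (combine x y) (combine x' y') ≡ zero
  colour-distinct {x} {x'} y y' x≢x' rewrite colour-combine x x' y y' | ==-≢ x≢x' = refl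

  colour-zero⁻ : ∀ {x x' y y'} → T (colour (combine x y) (combine x' y') == zero) → x ≢ x'
  colour-zero⁻ {x} {y = y} {y'} t refl = subst (λ d → T (d == zero)) (colour-same x y y') t

  colour-suc⁻ : ∀ {x x' y y' d} → T (colour (combine x y) (combine x' y') == suc d) → x ≡ x'
  colour-suc⁻ {x} {x'} {y} {y'} {d} t with x ≟ x'
  ... | yes x≡x' = x≡x'
  ... | no  x≢x' = ⊥-elim (subst (λ d' → T (d' == suc d)) (colour-distinct y y' x≢x') t)

  colour-sym : (∀ y y' → c y y' ≡ c y' y) → ∀ p q → colour p q ≡ colour q p
  colour-sym c-sym p q = ∀-combine (λ x y → ∀-combine (λ x' y' → symmetric x x' y y') q) p
    where
    symmetric : ∀ x x' y y' → colour (combine x y) (combine x' y') ≡ colour (combine x' y') (combine x y)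
    symmetric x x' y y'
      rewrite colour-combine x x' y y' | colour-combine x' x y' y | ==-sym x x' | c-sym y y' = refl

  module Counting (G-simple : IsSimple G) (K-simple : IsSimple K) where

    open Slices G-simple K-simple

    edge-zero-layer : ∀ {i x x' : Fin (n G)} {j y y' : Fin (n K)} →
      T (adj (G □ K) (combine x y) (combine x' y')) → T (inN (G □ K) (combine i j) (combine x y)) →
      T (inN (G □ K) (combine i j) (combine x' y')) → T (colour (combine x y) (combine x' y') == zero) →
      y ≡ j × y' ≡ j
    edge-zero-layer {i} {x} {x'} {j} {y} {y'} a n₁ n₂ c₀ with adj-□⁻ a
    ... | inj₁ (x≡x' , _) = ⊥-elim (colour-zero⁻ c₀ x≡x')
    ... | inj₂ (refl , _) with inN-□⁻ n₁ | inN-□⁻ n₂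
    ...   | inj₂ (refl , _) | _                = refl , refl
    ...   | inj₁ _          | inj₂ (refl , _)  = refl , refl
    ...   | inj₁ (refl , _) | inj₁ (refl , _)  = ⊥-elim (colour-zero⁻ c₀ refl)

    edge-suc-layer : ∀ {i x x' : Fin (n G)} {j y y' : Fin (n K)} {d} →
      T (adj (G □ K) (combine x y) (combine x' y')) → T (inN (G □ K) (combine i j) (combine x y)) →
      T (inN (G □ K) (combine i j) (combine x' y')) → T (colour (combine x y) (combine x' y') == suc d) →
      x ≡ i × x' ≡ i
    edge-suc-layer {i} {x} {x'} {j} {y} {y'} a n₁ n₂ cd with colour-suc⁻ cd
    ... | refl with adj-□⁻ a
    ...   | inj₂ (_ , a') = ⊥-elim (adj-irrefl G-simple x a')
    ...   | inj₁ (_ , a') with inN-□⁻ n₁ | inN-□⁻ n₂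
    ...     | inj₁ (refl , _) | _                = refl , refl
    ...     | inj₂ _          | inj₁ (refl , _)  = refl , refl
    ...     | inj₂ (refl , _) | inj₂ (refl , _)  = ⊥-elim (adj-irrefl K-simple _ a')

    degC-□-zero-combine : ∀ i j → degC (G □ K) colour zero (combine i j) ≡ deg G i
    degC-□-zero-combine i j =
      trans (count-sliceʳ {n G} j (colourNeighbour (G □ K) colour zero v) layer) (count-cong slice)
      where
      v : Fin (n (G □ K))
      v = combine i j
      layer : ∀ x y → T (colourNeighbour (G □ K) colour zero v (combine x y)) → y ≡ j
      layer x y t with to (T-∧ {adj (G □ K) v (combine x y)}) t
      ... | a , c₀ with adj-□⁻ {i} {x} {j} {y} a
      ...   | inj₁ (i≡x , _)  = ⊥-elim (colour-zero⁻ c₀ i≡x)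
      ...   | inj₂ (refl , _) = refl
      slice : ∀ x → colourNeighbour (G □ K) colour zero v (combine x j) ≡ adj G i x
      slice x with i ≟ x
      ... | yes refl rewrite adj-□-sliceʳ i i j | proj₂ G-simple i = refl
      ... | no  i≢x  rewrite adj-□-sliceʳ i x j | colour-distinct j j i≢x = ∧-identityʳ (adj G i x)

    degC-□-suc-combine : ∀ i j d → degC (G □ K) colour (suc d) (combine i j) ≡ degC K c d j
    degC-□-suc-combine i j d =
      trans (count-sliceˡ {n G} i (colourNeighbour (G □ K) colour (suc d) v) layer) (count-cong slice)
      where
      v : Fin (n (G □ K))
      v = combine i j
      layer : ∀ x y → T (colourNeighbour (G □ K) colour (suc d) v (combine x y)) → x ≡ i
      layer x y t = sym (colour-suc⁻ (proj₂ (to (T-∧ {adj (G □ K) v (combine x y)}) t)))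
      slice : ∀ y → colourNeighbour (G □ K) colour (suc d) v (combine i y) ≡ colourNeighbour K c d j y
      slice y rewrite adj-□-sliceˡ i j y | colour-same i j y | suc-== (c j y) d = refl

    eC-□-zero-combine : ∀ i j → eC (G □ K) colour zero (combine i j) ≡ e G i
    eC-□-zero-combine i j = trans (pairs-sliceʳ {n G} j (colourEdgeIn (G □ K) colour zero v) layer)
                                  (sumF-cong λ x → count-cong (slice x))
      where
      v : Fin (n (G □ K))
      v = combine i j
      layer : ∀ x x' y y' → T (colourEdgeIn (G □ K) colour zero v (combine x y) (combine x' y')) →
              y ≡ j × y' ≡ j
      layer x x' y y' t =
        let (a , n₁ , n₂ , c₀) = colourEdgeIn⁻ (G □ K) colour zero v (combine x y) (combine x' y') t
        in edge-zero-layer a n₁ n₂ c₀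
      slice : ∀ x x' →
              colourEdgeIn (G □ K) colour zero v (combine x j) (combine x' j) ≡ edgeIn G i x x'
      slice x x' with x ≟ x'
      ... | yes refl rewrite combine-<ᵇʳ x x j | adj-□-sliceʳ x x j | proj₂ G-simple x = refl
      ... | no  x≢x' rewrite combine-<ᵇʳ x x' j | adj-□-sliceʳ x x' j
                           | inN-□-sliceʳ i j x | inN-□-sliceʳ i j x'
                           | colour-distinct j j x≢x' | ∧-identityʳ (inN G i x') = refl

    eC-□-suc-combine : ∀ i j d → eC (G □ K) colour (suc d) (combine i j) ≡ eC K c d j
    eC-□-suc-combine i j d = trans (pairs-sliceˡ {n G} i (colourEdgeIn (G □ K) colour (suc d) v) layer)
                                   (sumF-cong λ y → count-cong (slice y))
      where
      v : Fin (n (G □ K))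
      v = combine i j
      layer : ∀ x x' y y' → T (colourEdgeIn (G □ K) colour (suc d) v (combine x y) (combine x' y')) →
              x ≡ i × x' ≡ i
      layer x x' y y' t =
        let (a , n₁ , n₂ , cd) =
              colourEdgeIn⁻ (G □ K) colour (suc d) v (combine x y) (combine x' y') t
        in edge-suc-layer a n₁ n₂ cd
      slice : ∀ y y' → colourEdgeIn (G □ K) colour (suc d) v (combine i y) (combine i y') ≡
                       colourEdgeIn K c d j y y'
      slice y y' rewrite combine-<ᵇˡ i y y' | adj-□-sliceˡ i y y'
                       | inN-□-sliceˡ i j y | inN-□-sliceˡ i j y'
                       | colour-same i y y' | suc-== (c y y') d = refl

    degC-□-zero : ∀ v → degC (G □ K) colour zero v ≡ deg G (proj₁ (remQuot {n G} (n K) v))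
    degC-□-zero = at-remQuot {g = λ i _ → deg G i} degC-□-zero-combine

    degC-□-suc : ∀ d v →
                 degC (G □ K) colour (suc d) v ≡ degC K c d (proj₂ (remQuot {n G} (n K) v))
    degC-□-suc d = at-remQuot {g = λ _ j → degC K c d j} (λ i j → degC-□-suc-combine i j d)

    eC-□-zero : ∀ v → eC (G □ K) colour zero v ≡ e G (proj₁ (remQuot {n G} (n K) v))
    eC-□-zero = at-remQuot {g = λ i _ → e G i} eC-□-zero-combine

    eC-□-suc : ∀ d v → eC (G □ K) colour (suc d) v ≡ eC K c d (proj₂ (remQuot {n G} (n K) v))
    eC-□-suc d = at-remQuot {g = λ _ j → eC K c d j} (λ i j → eC-□-suc-combine i j d)

coordinateColouring : (m : ℕ) (H : Fin (suc m) → Graph) → Colouring (prodAll m H) (suc m)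
coordinateColouring zero    H _ _ = zero
coordinateColouring (suc m) H =
  productColouring (H zero) (prodAll m (H ∘ suc)) (coordinateColouring m (H ∘ suc))

coordinate : (m : ℕ) (H : Fin (suc m) → Graph) (j : Fin (suc m)) →
             Fin (n (prodAll m H)) → Fin (n (H j))
coordinate zero    H zero    v = v
coordinate (suc m) H zero    v = proj₁ (remQuot {n (H zero)} (n (prodAll m (H ∘ suc))) v)
coordinate (suc m) H (suc j) v =
  coordinate m (H ∘ suc) j (proj₂ (remQuot {n (H zero)} (n (prodAll m (H ∘ suc))) v))

prodAll-simple : ∀ m H → (∀ j → IsSimple (H j)) → IsSimple (prodAll m H)
prodAll-simple zero    H simple = simple zero
prodAll-simple (suc m) H simple =
  Product.□-simple (simple zero) (prodAll-simple m (H ∘ suc) (simple ∘ suc))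

coordinateColouring-sym : ∀ m H p q → coordinateColouring m H p q ≡ coordinateColouring m H q p
coordinateColouring-sym zero    H p q = refl
coordinateColouring-sym (suc m) H =
  ProductColouring.colour-sym {H zero} {prodAll m (H ∘ suc)} (coordinateColouring m (H ∘ suc))
    (coordinateColouring-sym m (H ∘ suc))

module ProductStep (m : ℕ) (H : Fin (suc (suc m)) → Graph) (simple : ∀ j → IsSimple (H j)) =
  ProductColouring.Counting {H zero} {prodAll m (H ∘ suc)} (coordinateColouring m (H ∘ suc))
    (simple zero) (prodAll-simple m (H ∘ suc) (simple ∘ suc))

degC-coordinateColouring : ∀ m H → (∀ j → IsSimple (H j)) → ∀ j v →
  degC (prodAll m H) (coordinateColouring m H) j v ≡ deg (H j) (coordinate m H j v)
degC-coordinateColouring zero    H _      zero    v = count-cong λ w → ∧-identityʳ (adj (H zero) v w)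
degC-coordinateColouring (suc m) H simple zero    v = ProductStep.degC-□-zero m H simple v
degC-coordinateColouring (suc m) H simple (suc j) v =
  trans (ProductStep.degC-□-suc m H simple j v) (degC-coordinateColouring m (H ∘ suc) (simple ∘ suc) j _)

eC-coordinateColouring : ∀ m H → (∀ j → IsSimple (H j)) → ∀ j v →
  eC (prodAll m H) (coordinateColouring m H) j v ≡ e (H j) (coordinate m H j v)
eC-coordinateColouring zero    H _      zero    v =
  countEdges-cong (H zero) λ x y → cong (inN (H zero) v x ∧_) (∧-identityʳ (inN (H zero) v y))
eC-coordinateColouring (suc m) H simple zero    v = ProductStep.eC-□-zero m H simple v
eC-coordinateColouring (suc m) H simple (suc j) v =
  trans (ProductStep.eC-□-suc m H simple j v) (eC-coordinateColouring m (H ∘ suc) (simple ∘ suc) j _)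

lemma2p3 : (m : ℕ) (H : Fin (suc (suc m)) → Graph) (a : Fin (suc (suc m)) → ℕ) →
    StrictlyIncPos (suc (suc m)) a →
    (∀ j → IsSimple (H j)) →
    (∀ j → Regular (a j) (H j)) →
    (∀ i j → toℕ j ≡ suc (toℕ i) →
    ∀ (u : Fin (n (H j))) (v : Fin (n (H i))) → e (H j) u < e (H i) v) →
    IsFlipGraph (prodAll (suc m) H) (suc (suc m)) a
lemma2p3 m H a increasing simple regular e-decreasing =
  increasing , c , (λ x y _ → coordinateColouring-sym (suc m) H x y) , degrees , inequalities
  where
  c : Colouring (prodAll (suc m) H) (suc (suc m))
  c = coordinateColouring (suc m) H
  degrees : ∀ j v → degC (prodAll (suc m) H) c j v ≡ a j
  degrees j v = trans (degC-coordinateColouring (suc m) H simple j v) (regular j _)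
  inequalities : ∀ i j v → toℕ j ≡ suc (toℕ i) → eC (prodAll (suc m) H) c j v < eC (prodAll (suc m) H) c i v
  inequalities i j v j≡1+i = subst₂ _<_ (sym (e-coordinate j)) (sym (e-coordinate i)) (e-decreasing i j j≡1+i _ _)
    where
    e-coordinate : ∀ j → eC (prodAll (suc m) H) c j v ≡ e (H j) (coordinate (suc m) H j v)
    e-coordinate j = eC-coordinateColouring (suc m) H simple j v
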